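{- Let $\to$ be a binary relation on a set $A$ and $\bullet: A\to A$ a map. Then $\to$ has the Z-property for $\bullet$ if and only if there exists a relation $\Rightarrow$ on $A$ such that $\to$ has the angle property for $\bullet$ and $\Rightarrow$.
   Context: $\to^*$ denotes the reflexive–transitive closure of $\to$. The relation $\to$ has the Z-property for $\bullet$ if for all $a,b\in A$, $a\to b$ implies $b\to^* a^\bullet$ and $a^\bullet\to^* b^\bullet$. The relation $\to$ has the angle property for the map $\bullet$ and a relation $\Rightarrow$ on $A$ if ${\to}\subseteq{\Rightarrow}\subseteq{\to^*}$ and for all $a,b\in A$, $a\Rightarrow b$ implies $b\Rightarrow a^\bullet$. -}

module Defs where

open import Data.Product using (_×_)
open import Relation.Binary.Core using (Rel; _⇒_)
open import Relation.Binary.Construct.Closure.ReflexiveTransitive using (Star)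

ZProperty : {A : Set} → Rel A _ → (A → A) → Set
ZProperty {A} R f = ∀ {a b : A} → R a b → Star R b (f a) × Star R (f a) (f b)

AngleProperty : {A : Set} → Rel A _ → (A → A) → Rel A _ → Set
AngleProperty {A} R f S =
  (R ⇒ S) × (S ⇒ Star R) × (∀ {a b : A} → S a b → S b (f a))

-- The angle property yields the Z-property by going around the angle twice: from a → b we get
-- a ⇒ b, hence b ⇒ a• and a• ⇒ b•, both of which lie in →*. Conversely, under the Z-property
-- the relation "a →* b →* a•" is an angle relation: the first condition of the Z-property puts
-- → inside it, and its second condition makes • monotone on →*, which is what closes the angle.
module Submission where

open import Defs
open import Data.Product using (∃; _,_; _×_; proj₁; proj₂)
open import Function.Base using (_∘_)
open import Function.Bundles using (_⇔_; mk⇔)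
open import Level using (0ℓ)
open import Relation.Binary.Core using (Rel; _=[_]⇒_)
open import Relation.Binary.Construct.Closure.ReflexiveTransitive
  using (Star; _◅_; ε; kleisliStar)

module _ {A : Set} {R : Rel A 0ℓ} {f : A → A} where

  Z⇒monotone : ZProperty R f → Star R =[ f ]⇒ Star R
  Z⇒monotone z = kleisliStar f (proj₂ ∘ z)

  Sandwich : Rel A 0ℓ
  Sandwich a b = Star R a b × Star R b (f a)

  Z⇒angle-sandwich : ZProperty R f → AngleProperty R f Sandwich
  Z⇒angle-sandwich z =
      (λ r → r ◅ ε , proj₁ (z r))
    , proj₁
    , λ { (a→*b , b→*fa) → b→*fa , Z⇒monotone z a→*b }

  Z⇒angle : ZProperty R f → ∃ (AngleProperty R f)
  Z⇒angle z = Sandwich , Z⇒angle-sandwich z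

  angle⇒Z : ∃ (AngleProperty R f) → ZProperty R f
  angle⇒Z (_ , R⊆S , S⊆R* , turn) r = S⊆R* (turn (R⊆S r)) , S⊆R* (turn (turn (R⊆S r)))

mainTheorem5 : (A : Set) (R : Rel A 0ℓ) (f : A → A) →
    ZProperty R f ⇔ ∃ (λ (S : Rel A 0ℓ) → AngleProperty R f S)
mainTheorem5 A R f = mk⇔ Z⇒angle angle⇒Z
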